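{- The relation on group packets in $(q+2)\text{ -GP}(n)$ defined by declaring $(G,H_i)$ and $(G',H'_i)$ equivalent if there exist a group packet $(G'',H''_i)$ in $(q+2)\text{ -GP}(n)$ and admissible morphisms $\alpha\colon (G,H_i)\to(G'',H''_i)$ and $\beta\colon (G',H'_i)\to(G'',H''_i)$ is an equivalence relation.
   Context: A group packet in $(q+2)\text{ -GP}(n)$ is the data $(G,H_i)_{i=1}^{q+2}$ of a group $G$ and subgroups $H_i\le G$ such that there is a subgroup $K$ with $H_i\cap H_j=K$ for all $i\neq j$ and $[G:H_i]=[H_i:K]=n$ for all $i$. An admissible morphism $\alpha\colon(G,H_i)\to(G',H'_i)$ is a group homomorphism $\alpha\colon G\to G'$ with $\alpha(H_i)\subset H'_i$ for all $i$ such that each induced map $G/H_i\to G'/H'_i$, $gH_i\mapsto\alpha(g)H'_i$, is a bijection. -}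

module Defs where

open import Level using (Level; _⊔_) renaming (suc to lsuc)
open import Data.Nat using (ℕ; suc)
open import Data.Fin using (Fin)
open import Data.Product using (Σ; Σ-syntax; ∃; ∃-syntax; _×_; _,_)
open import Relation.Binary.PropositionalEquality using (_≡_; _≢_)
open import Relation.Unary using (Pred)
open import Algebra.Bundles using (Group)
open import Algebra.Morphism.Structures using (IsGroupHomomorphism)

record IsSubgroup {c ℓ p : Level} (G : Group c ℓ) (H : Pred (Group.Carrier G) p)
       : Set (c ⊔ ℓ ⊔ p) where
  open Group G
  field
    resp  : ∀ {x y} → x ≈ y → H x → H y
    ε-mem : H ε
    ∙-mem : ∀ {x y} → H x → H y → H (x ∙ y)
    ⁻¹-mem : ∀ {x} → H x → H (x ⁻¹)

-- [G : H] = n : there are n left cosets of H in G, i.e. a family of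
-- representatives r : Fin n → G such that every g ∈ G lies in exactly one
-- coset (r i) H  (g ∈ (r i) H  iff  (r i)⁻¹ g ∈ H).
IndexInGroup : {c ℓ p : Level} (G : Group c ℓ) (H : Pred (Group.Carrier G) p) (n : ℕ)
               → Set (c ⊔ p)
IndexInGroup G H n =
  Σ[ r ∈ (Fin n → Carrier) ]
    (∀ g → Σ[ i ∈ Fin n ] (H ((r i) ⁻¹ ∙ g) × (∀ j → H ((r j) ⁻¹ ∙ g) → j ≡ i)))
  where open Group G

IndexIn : {c ℓ p : Level} (G : Group c ℓ) (H K : Pred (Group.Carrier G) p) (n : ℕ)
          → Set (c ⊔ p)
IndexIn G H K n =
  Σ[ r ∈ (Fin n → Carrier) ]
    ((∀ i → H (r i)) ×
     (∀ h → H h → Σ[ i ∈ Fin n ] (K ((r i) ⁻¹ ∙ h) × (∀ j → K ((r j) ⁻¹ ∙ h) → j ≡ i))))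
  where open Group G

record GroupPacket (c ℓ p : Level) (m n : ℕ) : Set (lsuc (c ⊔ ℓ ⊔ p)) where
  field
    G     : Group c ℓ
    H     : Fin m → Pred (Group.Carrier G) p
    H-sub : ∀ i → IsSubgroup G (H i)
    K     : Pred (Group.Carrier G) p
    K-sub : IsSubgroup G K
    meet  : ∀ i j → i ≢ j → ∀ g → ((H i g × H j g) → K g) × (K g → (H i g × H j g))
    idxG  : ∀ i → IndexInGroup G (H i) n
    idxH  : ∀ i → IndexIn G (H i) K n

-- An admissible morphism (G, H i) → (G', H' i): a group homomorphism
-- α with α(H i) ⊆ H' i such that each induced map G/H i → G'/H' i,
-- g H i ↦ α(g) H' i, is a bijection (surjective and injective on cosets).
record Admissible {c ℓ p : Level} {m n : ℕ} (P P' : GroupPacket c ℓ p m n)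
       : Set (c ⊔ ℓ ⊔ p) where
  private
    module P  = GroupPacket P
    module P' = GroupPacket P'
    module G  = Group P.G
    module G' = Group P'.G
  field
    α      : G.Carrier → G'.Carrier
    hom    : IsGroupHomomorphism G.rawGroup G'.rawGroup α
    maps   : ∀ i g → P.H i g → P'.H i (α g)
    surj   : ∀ i (g' : G'.Carrier) → Σ[ g ∈ G.Carrier ] P'.H i ((α g) G'.⁻¹ G'.∙ g')
    inj    : ∀ i (g₁ g₂ : G.Carrier) →
             P'.H i ((α g₁) G'.⁻¹ G'.∙ α g₂) → P.H i (g₁ G.⁻¹ G.∙ g₂)

_∼GP_ : {c ℓ p : Level} {m n : ℕ} → GroupPacket c ℓ p m n → GroupPacket c ℓ p m n
        → Set (lsuc (c ⊔ ℓ ⊔ p))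
_∼GP_ {c} {ℓ} {p} {m} {n} P P' =
  Σ[ P'' ∈ GroupPacket c ℓ p m n ] (Admissible P P'' × Admissible P' P'')

{-# OPTIONS --safe #-}
-- Read a packet P as an incidence geometry: the points are the elements g of G, the lines
-- of class i are the cosets g H i, and since H i ∩ H j = K, two points sharing lines of two
-- different classes share all their lines. The permutations of the lines that map points to
-- points form a group, and the stabilisers of the lines through ε make it a packet
-- AutPacket P, whose index data is transported from P by left translations. An admissible
-- β : P → Q identifies the lines of Q with those of P class by class, so left multiplication
-- in Q acts on the lines of P. It maps points to points because of a counting argument
-- (H₀/K and G/H₁ both have n elements): every point of Q shares all its lines with a point
-- in the image of β. This gives an admissible Q → AutPacket P, so if P ~ P′ through Q and
-- P′ ~ P″ through R, then P and P″ both map admissibly to AutPacket P′.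

module Submission where

open import Defs
open import Level using (Level; Lift; lift)
open import Data.Nat using (ℕ; suc)
import Data.Nat.Properties as ℕ
open import Data.Fin using (Fin; zero; suc; punchOut)
open import Data.Fin.Properties using (any?; injective⇒≤; punchOut-injective)
  renaming (_≟_ to _≟ᶠ_)
open import Data.Fin.Permutation using (Permutation′; _⟨$⟩ʳ_; _⟨$⟩ˡ_; _∘ₚ_)
import Data.Fin.Permutation as Perm
open import Data.Product using (∃; ∃-syntax; Σ-syntax; _×_; _,_; proj₁; proj₂)
open import Function.Base using (_∘_)
open import Function.Definitions using (Injective)
open import Relation.Binary.PropositionalEquality as ≡ using (_≡_; _≢_; refl; cong; subst)
open import Relation.Binary.Structures using (IsEquivalence)
open import Relation.Nullary using (yes; no)
open import Relation.Nullary.Negation using (contradiction)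
open import Relation.Unary using (Pred)
open import Algebra.Bundles using (Group)
open import Algebra.Morphism.Structures using (IsGroupHomomorphism)
import Algebra.Properties.Group as GroupProperties
import Algebra.Morphism.Construct.Composition as HomComposition
import Algebra.Morphism.Construct.Identity as HomIdentity

injective⇒surjective : ∀ {n} {f : Fin n → Fin n} → Injective _≡_ _≡_ f →
                       ∀ y → ∃ λ x → f x ≡ y
injective⇒surjective {suc n} {f} f-injective y with any? (λ x → f x ≟ᶠ y)
... | yes found = found
... | no  f≢y   = contradiction (injective⇒≤ punchOut∘f-injective) ℕ.1+n≰n
  where
  y≢f : ∀ x → y ≢ f x
  y≢f x y≡fx = f≢y (x , ≡.sym y≡fx)

  punchOut∘f : Fin (suc n) → Fin n
  punchOut∘f x = punchOut (y≢f x)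

  punchOut∘f-injective : Injective _≡_ _≡_ punchOut∘f
  punchOut∘f-injective eq = f-injective (punchOut-injective (y≢f _) (y≢f _) eq)

module CancellationLemmas {c ℓ : Level} (G : Group c ℓ) where
  open Group G
  open GroupProperties G using (⁻¹-anti-homo-∙; ε⁻¹≈ε; \\-leftDividesˡ; \\-leftDividesʳ)
  open import Relation.Binary.Reasoning.Setoid setoid

  x∙y∙[y⁻¹∙z]≈x∙z : ∀ x y z → (x ∙ y) ∙ (y ⁻¹ ∙ z) ≈ x ∙ z
  x∙y∙[y⁻¹∙z]≈x∙z x y z = begin
    (x ∙ y) ∙ (y ⁻¹ ∙ z)  ≈⟨ assoc x y _ ⟩
    x ∙ (y ∙ (y ⁻¹ ∙ z))  ≈⟨ ∙-congˡ (\\-leftDividesˡ y z) ⟩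
    x ∙ z                 ∎

  [x∙y]⁻¹∙[x∙z]≈y⁻¹∙z : ∀ x y z → (x ∙ y) ⁻¹ ∙ (x ∙ z) ≈ y ⁻¹ ∙ z
  [x∙y]⁻¹∙[x∙z]≈y⁻¹∙z x y z = begin
    (x ∙ y) ⁻¹ ∙ (x ∙ z)       ≈⟨ ∙-congʳ (⁻¹-anti-homo-∙ x y) ⟩
    (y ⁻¹ ∙ x ⁻¹) ∙ (x ∙ z)    ≈⟨ assoc (y ⁻¹) (x ⁻¹) _ ⟩
    y ⁻¹ ∙ (x ⁻¹ ∙ (x ∙ z))    ≈⟨ ∙-congˡ (\\-leftDividesʳ x z) ⟩
    y ⁻¹ ∙ z                   ∎

  ε⁻¹∙x≈x : ∀ x → ε ⁻¹ ∙ x ≈ x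
  ε⁻¹∙x≈x x = trans (∙-congʳ ε⁻¹≈ε) (identityˡ x)

module Cosets {c ℓ p : Level} {G : Group c ℓ} {H : Pred (Group.Carrier G) p} {n : ℕ}
              (H-sub : IsSubgroup G H) (index : IndexInGroup G H n) where
  open Group G
  open CancellationLemmas G
  open IsSubgroup H-sub

  rep : Fin n → Carrier
  rep = proj₁ index

  coset : Carrier → Fin n
  coset g = proj₁ (proj₂ index g)

  private
    rep⁻¹∙g∈H : ∀ g → H (rep (coset g) ⁻¹ ∙ g)
    rep⁻¹∙g∈H g = proj₁ (proj₂ (proj₂ index g))

    coset-unique : ∀ g j → H (rep j ⁻¹ ∙ g) → j ≡ coset g
    coset-unique g = proj₂ (proj₂ (proj₂ index g))

  coset≡⇒∈H : ∀ {g g′} → coset g ≡ coset g′ → H (g ⁻¹ ∙ g′)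
  coset≡⇒∈H {g} {g′} eq = resp ([x∙y]⁻¹∙[x∙z]≈y⁻¹∙z (rep (coset g) ⁻¹) g g′)
    (∙-mem (⁻¹-mem (rep⁻¹∙g∈H g))
           (subst (λ a → H (rep a ⁻¹ ∙ g′)) (≡.sym eq) (rep⁻¹∙g∈H g′)))

  ∈H⇒coset≡ : ∀ {g g′} → H (g ⁻¹ ∙ g′) → coset g ≡ coset g′
  ∈H⇒coset≡ {g} {g′} g⁻¹g′∈H = coset-unique g′ (coset g)
    (resp (x∙y∙[y⁻¹∙z]≈x∙z _ g g′) (∙-mem (rep⁻¹∙g∈H g) g⁻¹g′∈H))

  coset-cong : ∀ {g g′} → g ≈ g′ → coset g ≡ coset g′
  coset-cong {g} g≈g′ =
    ∈H⇒coset≡ (resp (sym (trans (∙-congˡ (sym g≈g′)) (inverseˡ g))) ε-mem)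

  coset-rep : ∀ a → coset (rep a) ≡ a
  coset-rep a = ≡.sym (coset-unique (rep a) a (resp (sym (inverseˡ (rep a))) ε-mem))

  coset-∙ˡ : ∀ x {y y′} → coset y ≡ coset y′ → coset (x ∙ y) ≡ coset (x ∙ y′)
  coset-∙ˡ x {y} {y′} eq =
    ∈H⇒coset≡ (resp (sym ([x∙y]⁻¹∙[x∙z]≈y⁻¹∙z x y y′)) (coset≡⇒∈H eq))

  coset-∙∈H : ∀ x {h} → H h → coset (x ∙ h) ≡ coset x
  coset-∙∈H x {h} h∈H =
    ≡.sym (∈H⇒coset≡ (resp (sym (GroupProperties.\\-leftDividesʳ G x h)) h∈H))

  ∈H⇒coset≡cosetε : ∀ {g} → H g → coset g ≡ coset ε
  ∈H⇒coset≡cosetε {g} g∈H = ≡.sym (∈H⇒coset≡ (resp (sym (ε⁻¹∙x≈x g)) g∈H))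

  coset≡cosetε⇒∈H : ∀ {g} → coset g ≡ coset ε → H g
  coset≡cosetε⇒∈H {g} eq = resp (ε⁻¹∙x≈x g) (coset≡⇒∈H (≡.sym eq))

module PacketProperties {c ℓ p : Level} {q n : ℕ} (P : GroupPacket c ℓ p (suc (suc q)) n) where
  open GroupPacket P public
  open Group G public
  module Hᵢ i = IsSubgroup (H-sub i)
  module Kₛ = IsSubgroup K-sub
  module Coset (i : Fin (suc (suc q))) = Cosets (H-sub i) (idxG i)
  open Coset public

  base : Fin (suc (suc q)) → Fin n
  base i = coset i ε

  H∩H⊆K : ∀ {i j} → i ≢ j → ∀ {g} → H i g → H j g → K g
  H∩H⊆K i≢j g∈Hᵢ g∈Hⱼ = proj₁ (meet _ _ i≢j _) (g∈Hᵢ , g∈Hⱼ)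

  K⊆H : ∀ i {g} → K g → H i g
  K⊆H zero    g∈K = proj₁ (proj₂ (meet zero (suc zero) (λ ()) _) g∈K)
  K⊆H (suc i) g∈K = proj₁ (proj₂ (meet (suc i) zero (λ ()) _) g∈K)

  coset≡-on-two⇒coset≡ : ∀ {i j} → i ≢ j → ∀ {g g′} →
                         coset i g ≡ coset i g′ → coset j g ≡ coset j g′ →
                         ∀ k → coset k g ≡ coset k g′
  coset≡-on-two⇒coset≡ i≢j eqᵢ eqⱼ k =
    ∈H⇒coset≡ k (K⊆H k (H∩H⊆K i≢j (coset≡⇒∈H _ eqᵢ) (coset≡⇒∈H _ eqⱼ)))

  repᴷ : Fin (suc (suc q)) → Fin n → Carrier
  repᴷ i = proj₁ (idxH i)

  repᴷ∈H : ∀ i a → H i (repᴷ i a)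
  repᴷ∈H i = proj₁ (proj₂ (idxH i))

  Kcoset : ∀ i h → H i h →
           Σ[ a ∈ Fin n ] (K (repᴷ i a ⁻¹ ∙ h) × (∀ b → K (repᴷ i b ⁻¹ ∙ h) → b ≡ a))
  Kcoset i = proj₂ (proj₂ (idxH i))

  repᴷ-injective : ∀ i {a a′} → K (repᴷ i a ⁻¹ ∙ repᴷ i a′) → a ≡ a′
  repᴷ-injective i {a} {a′} a⁻¹a′∈K =
    ≡.trans (unique a a⁻¹a′∈K) (≡.sym (unique a′ (Kₛ.resp (sym (inverseˡ _)) Kₛ.ε-mem)))
    where unique = proj₂ (proj₂ (Kcoset i (repᴷ i a′) (repᴷ∈H i a′)))

module CosetGeometry {c ℓ p : Level} {q n : ℕ} (P : GroupPacket c ℓ p (suc (suc q)) n) where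
  open PacketProperties P using (coset; base; ε; coset≡-on-two⇒coset≡)

  PreservesPoints : (Fin (suc (suc q)) → Fin n → Fin n) → Set c
  PreservesPoints f = ∀ g → ∃[ g′ ] ∀ k → f k (coset k g) ≡ coset k g′

  ∘-preservesPoints : ∀ {f f′} → PreservesPoints f → PreservesPoints f′ →
                      PreservesPoints (λ k a → f k (f′ k a))
  ∘-preservesPoints {f} f-pres f′-pres g =
    let g′ , eq′ = f′-pres g
        g″ , eq  = f-pres g′
    in g″ , λ k → ≡.trans (cong (f k) (eq′ k)) (eq k)

  record Automorphism : Set c where
    field
      perm        : Fin (suc (suc q)) → Permutation′ n
      preserves   : PreservesPoints (λ k → perm k ⟨$⟩ʳ_)
      preserves⁻¹ : PreservesPoints (λ k → perm k ⟨$⟩ˡ_)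
  open Automorphism public

  infix  4 _≈ᴬ_
  infixl 7 _∙ᴬ_
  infix  8 _⁻¹ᴬ

  _≈ᴬ_ : Automorphism → Automorphism → Set ℓ
  x ≈ᴬ y = Lift ℓ (∀ i → perm x i Perm.≈ perm y i)

  _∙ᴬ_ : Automorphism → Automorphism → Automorphism
  x ∙ᴬ y = record
    { perm        = λ i → perm y i ∘ₚ perm x i
    ; preserves   = ∘-preservesPoints {f = λ k → perm x k ⟨$⟩ʳ_} {f′ = λ k → perm y k ⟨$⟩ʳ_}
                                      (preserves x) (preserves y)
    ; preserves⁻¹ = ∘-preservesPoints {f = λ k → perm y k ⟨$⟩ˡ_} {f′ = λ k → perm x k ⟨$⟩ˡ_}
                                      (preserves⁻¹ y) (preserves⁻¹ x)
    }

  εᴬ : Automorphism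
  εᴬ = record
    { perm        = λ _ → Perm.id
    ; preserves   = λ g → g , λ _ → refl
    ; preserves⁻¹ = λ g → g , λ _ → refl
    }

  _⁻¹ᴬ : Automorphism → Automorphism
  x ⁻¹ᴬ = record
    { perm        = λ i → Perm.flip (perm x i)
    ; preserves   = preserves⁻¹ x
    ; preserves⁻¹ = preserves x
    }

  ⁻¹ᴬ-cong : ∀ {x y} → x ≈ᴬ y → x ⁻¹ᴬ ≈ᴬ y ⁻¹ᴬ
  ⁻¹ᴬ-cong {x} {y} (lift x≈y) = lift λ i a → begin
    perm x i ⟨$⟩ˡ a
      ≡⟨ cong (perm x i ⟨$⟩ˡ_) (Perm.inverseʳ (perm y i)) ⟨
    perm x i ⟨$⟩ˡ (perm y i ⟨$⟩ʳ (perm y i ⟨$⟩ˡ a))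
      ≡⟨ cong (perm x i ⟨$⟩ˡ_) (x≈y i _) ⟨
    perm x i ⟨$⟩ˡ (perm x i ⟨$⟩ʳ (perm y i ⟨$⟩ˡ a))
      ≡⟨ Perm.inverseˡ (perm x i) ⟩
    perm y i ⟨$⟩ˡ a
      ∎
    where open ≡.≡-Reasoning

  AutGroup : Group c ℓ
  AutGroup = record
    { Carrier = Automorphism
    ; _≈_     = _≈ᴬ_
    ; _∙_     = _∙ᴬ_
    ; ε       = εᴬ
    ; _⁻¹     = _⁻¹ᴬ
    ; isGroup = record
      { isMonoid = record
        { isSemigroup = record
          { isMagma = record
            { isEquivalence = record
              { refl  = lift λ _ _ → refl
              ; sym   = λ (lift x≈y) → lift λ i a → ≡.sym (x≈y i a)
              ; trans = λ (lift x≈y) (lift y≈z) → lift λ i a → ≡.trans (x≈y i a) (y≈z i a)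
              }
            ; ∙-cong = λ {x} {_} {_} {v} (lift x≈y) (lift u≈v) → lift λ i a →
                ≡.trans (cong (perm x i ⟨$⟩ʳ_) (u≈v i a)) (x≈y i (perm v i ⟨$⟩ʳ a))
            }
          ; assoc = λ _ _ _ → lift λ _ _ → refl
          }
        ; identity = (λ _ → lift λ _ _ → refl) , (λ _ → lift λ _ _ → refl)
        }
      ; inverse = (λ x → lift λ i _ → Perm.inverseˡ (perm x i))
                , (λ x → lift λ i _ → Perm.inverseʳ (perm x i))
      ; ⁻¹-cong = λ {x} {y} → ⁻¹ᴬ-cong {x} {y}
      }
    }

  Stab : Fin (suc (suc q)) → Pred Automorphism p
  Stab i x = Lift p (perm x i ⟨$⟩ʳ base i ≡ base i)

  Stab-sub : ∀ i → IsSubgroup AutGroup (Stab i)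
  Stab-sub i = record
    { resp   = λ (lift x≈y) (lift fixed) → lift (≡.trans (≡.sym (x≈y i (base i))) fixed)
    ; ε-mem  = lift refl
    ; ∙-mem  = λ {x} (lift x-fixes) (lift y-fixes) →
        lift (≡.trans (cong (perm x i ⟨$⟩ʳ_) y-fixes) x-fixes)
    ; ⁻¹-mem = λ {x} (lift fixed) →
        lift (≡.trans (cong (perm x i ⟨$⟩ˡ_) (≡.sym fixed)) (Perm.inverseˡ (perm x i)))
    }

  StabAll : Pred Automorphism p
  StabAll x = ∀ k → Stab k x

  StabAll-sub : IsSubgroup AutGroup StabAll
  StabAll-sub = record
    { resp   = λ {x} {y} x≈y fixed k → Stab-sub.resp k {x} {y} x≈y (fixed k)
    ; ε-mem  = λ k → Stab-sub.ε-mem k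
    ; ∙-mem  = λ {x} {y} x-fixes y-fixes k → Stab-sub.∙-mem k {x} {y} (x-fixes k) (y-fixes k)
    ; ⁻¹-mem = λ {x} fixed k → Stab-sub.⁻¹-mem k {x} (fixed k)
    }
    where module Stab-sub k = IsSubgroup (Stab-sub k)

  Stab∩Stab⊆StabAll : ∀ {i j} → i ≢ j → ∀ {x} → Stab i x → Stab j x → StabAll x
  Stab∩Stab⊆StabAll {i} {j} i≢j {x} (lift fixesᵢ) (lift fixesⱼ) k =
    lift (≡.trans (image≡ k) (≡.sym (base≡ k)))
    where
    g′     = proj₁ (preserves x ε)
    image≡ = proj₂ (preserves x ε)

    base≡ : ∀ k → base k ≡ coset k g′
    base≡ = coset≡-on-two⇒coset≡ i≢j (≡.trans (≡.sym fixesᵢ) (image≡ i))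
                                     (≡.trans (≡.sym fixesⱼ) (image≡ j))

  meetᴬ : ∀ i j → i ≢ j → ∀ x →
          ((Stab i x × Stab j x) → StabAll x) × (StabAll x → (Stab i x × Stab j x))
  meetᴬ i j i≢j x = (λ (xᵢ , xⱼ) → Stab∩Stab⊆StabAll i≢j {x} xᵢ xⱼ) , λ fixed → fixed i , fixed j

module AdmissibleProperties {c ℓ p : Level} {m n : ℕ} {P Q : GroupPacket c ℓ p m n}
                            (β : Admissible P Q) where
  private
    module P = GroupPacket P
    module Q = GroupPacket Q
    module G = Group P.G
    module G′ = Group Q.G
  open Admissible β
  module α-hom = IsGroupHomomorphism hom

  α-⁻¹∙ : ∀ g₁ g₂ → α (g₁ G.⁻¹ G.∙ g₂) G′.≈ α g₁ G′.⁻¹ G′.∙ α g₂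
  α-⁻¹∙ g₁ g₂ = G′.trans (α-hom.homo _ g₂) (G′.∙-congʳ (α-hom.⁻¹-homo g₁))

  maps-⁻¹∙ : ∀ i {g₁ g₂} → P.H i (g₁ G.⁻¹ G.∙ g₂) → Q.H i (α g₁ G′.⁻¹ G′.∙ α g₂)
  maps-⁻¹∙ i {g₁} {g₂} g₁⁻¹g₂∈H =
    IsSubgroup.resp (Q.H-sub i) (α-⁻¹∙ g₁ g₂) (maps i _ g₁⁻¹g₂∈H)

admissible-id : ∀ {c ℓ p : Level} {m n : ℕ} (P : GroupPacket c ℓ p m n) → Admissible P P
admissible-id P = record
  { α    = λ g → g
  ; hom  = HomIdentity.isGroupHomomorphism G.rawGroup G.refl
  ; maps = λ _ _ g∈H → g∈H
  ; surj = λ i g → g , Hᵢ.resp i (G.sym (G.inverseˡ g)) (Hᵢ.ε-mem i)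
  ; inj  = λ _ _ _ g₁⁻¹g₂∈H → g₁⁻¹g₂∈H
  }
  where
  open GroupPacket P
  module G = Group G
  module Hᵢ i = IsSubgroup (H-sub i)

admissible-∘ : ∀ {c ℓ p : Level} {m n : ℕ} {P Q R : GroupPacket c ℓ p m n} →
               Admissible Q R → Admissible P Q → Admissible P R
admissible-∘ {R = R} β γ = record
  { α    = λ g → β.α (γ.α g)
  ; hom  = HomComposition.isGroupHomomorphism G″.trans γ.hom β.hom
  ; maps = λ i g g∈H → β.maps i _ (γ.maps i g g∈H)
  ; surj = surj
  ; inj  = λ i g₁ g₂ h → γ.inj i g₁ g₂ (β.inj i _ _ h)
  }
  where
  module β = Admissible β
  module γ = Admissible γ
  module G″ = Group (GroupPacket.G R)
  module H″ i = IsSubgroup (GroupPacket.H-sub R i)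

  surj : ∀ i z → ∃[ g ] GroupPacket.H R i (β.α (γ.α g) G″.⁻¹ G″.∙ z)
  surj i z = g , H″.resp i (CancellationLemmas.x∙y∙[y⁻¹∙z]≈x∙z (GroupPacket.G R) _ _ _)
                   (H″.∙-mem i (AdmissibleProperties.maps-⁻¹∙ β i g⁻¹y∈H) y⁻¹z∈H)
    where
    y = proj₁ (β.surj i z)
    y⁻¹z∈H = proj₂ (β.surj i z)
    g = proj₁ (γ.surj i y)
    g⁻¹y∈H = proj₂ (γ.surj i y)

module Transport {c ℓ p : Level} {q n : ℕ} {P Q : GroupPacket c ℓ p (suc (suc q)) n}
                 (β : Admissible P Q) where
  private
    module P = PacketProperties P
    module Q = PacketProperties Q
  open Admissible β using (α; surj; inj)
  open AdmissibleProperties β using (maps-⁻¹∙; module α-hom)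
  open Q using (_∙_; _⁻¹; _≈_; ε)
  open CosetGeometry P using (PreservesPoints; Automorphism; AutGroup)
  open ≡.≡-Reasoning

  coset-α : ∀ i {g₁ g₂} → P.coset i g₁ ≡ P.coset i g₂ → Q.coset i (α g₁) ≡ Q.coset i (α g₂)
  coset-α i eq = Q.∈H⇒coset≡ i (maps-⁻¹∙ i (P.coset≡⇒∈H i eq))

  coset-α⁻¹ : ∀ i {g₁ g₂} → Q.coset i (α g₁) ≡ Q.coset i (α g₂) → P.coset i g₁ ≡ P.coset i g₂
  coset-α⁻¹ i {g₁} {g₂} eq = P.∈H⇒coset≡ i (inj i g₁ g₂ (Q.coset≡⇒∈H i eq))

  ᾱ : Fin (suc (suc q)) → Fin n → Fin n
  ᾱ i a = Q.coset i (α (P.rep i a))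

  ᾱ-coset : ∀ i g → ᾱ i (P.coset i g) ≡ Q.coset i (α g)
  ᾱ-coset i g = coset-α i (P.coset-rep i (P.coset i g))

  ᾱ-base : ∀ i → ᾱ i (P.base i) ≡ Q.base i
  ᾱ-base i = ≡.trans (ᾱ-coset i P.ε) (Q.coset-cong i α-hom.ε-homo)

  ᾱ-injective : ∀ i → Injective _≡_ _≡_ (ᾱ i)
  ᾱ-injective i {a} {a′} eq = begin
    a                      ≡⟨ P.coset-rep i a ⟨
    P.coset i (P.rep i a)  ≡⟨ coset-α⁻¹ i eq ⟩
    P.coset i (P.rep i a′) ≡⟨ P.coset-rep i a′ ⟩
    a′                     ∎

  preimage : Fin (suc (suc q)) → Q.Carrier → P.Carrier
  preimage i y = proj₁ (surj i y)

  coset-α-preimage : ∀ i y → Q.coset i (α (preimage i y)) ≡ Q.coset i y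
  coset-α-preimage i y = Q.∈H⇒coset≡ i (proj₂ (surj i y))

  -- Left multiplication of Q on its cosets, pulled back along the bijections ᾱ i.
  act : Q.Carrier → Fin (suc (suc q)) → Fin n → Fin n
  act y i a = P.coset i (preimage i (y ∙ α (P.rep i a)))

  ᾱ-act : ∀ y i a → ᾱ i (act y i a) ≡ Q.coset i (y ∙ α (P.rep i a))
  ᾱ-act y i a = ≡.trans (ᾱ-coset i _) (coset-α-preimage i _)

  ᾱ-act-coset : ∀ y i g → ᾱ i (act y i (P.coset i g)) ≡ Q.coset i (y ∙ α g)
  ᾱ-act-coset y i g = ≡.trans (ᾱ-act y i _) (Q.coset-∙ˡ i y (ᾱ-coset i g))

  ᾱ-act-base : ∀ y i → ᾱ i (act y i (P.base i)) ≡ Q.coset i y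
  ᾱ-act-base y i = ≡.trans (ᾱ-act-coset y i P.ε)
    (Q.coset-cong i (Q.trans (Q.∙-congˡ α-hom.ε-homo) (Q.identityʳ y)))

  act-cong : ∀ {y y′} → y ≈ y′ → ∀ i a → act y i a ≡ act y′ i a
  act-cong {y} {y′} y≈y′ i a = ᾱ-injective i (begin
    ᾱ i (act y i a)                ≡⟨ ᾱ-act y i a ⟩
    Q.coset i (y ∙ α (P.rep i a))  ≡⟨ Q.coset-cong i (Q.∙-congʳ y≈y′) ⟩
    Q.coset i (y′ ∙ α (P.rep i a)) ≡⟨ ᾱ-act y′ i a ⟨
    ᾱ i (act y′ i a)               ∎)

  act-∙ : ∀ y₁ y₂ i a → act (y₁ ∙ y₂) i a ≡ act y₁ i (act y₂ i a)
  act-∙ y₁ y₂ i a = ᾱ-injective i (begin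
    ᾱ i (act (y₁ ∙ y₂) i a)                     ≡⟨ ᾱ-act (y₁ ∙ y₂) i a ⟩
    Q.coset i ((y₁ ∙ y₂) ∙ α (P.rep i a))       ≡⟨ Q.coset-cong i (Q.assoc y₁ y₂ _) ⟩
    Q.coset i (y₁ ∙ (y₂ ∙ α (P.rep i a)))       ≡⟨ Q.coset-∙ˡ i y₁ (ᾱ-act y₂ i a) ⟨
    Q.coset i (y₁ ∙ α (P.rep i (act y₂ i a)))   ≡⟨ ᾱ-act y₁ i _ ⟨
    ᾱ i (act y₁ i (act y₂ i a))                 ∎)

  act-ε : ∀ i a → act ε i a ≡ a
  act-ε i a = ᾱ-injective i (≡.trans (ᾱ-act ε i a) (Q.coset-cong i (Q.identityˡ _)))

  act-inverseʳ : ∀ y i a → act y i (act (y ⁻¹) i a) ≡ a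
  act-inverseʳ y i a = begin
    act y i (act (y ⁻¹) i a) ≡⟨ act-∙ y (y ⁻¹) i a ⟨
    act (y ∙ y ⁻¹) i a       ≡⟨ act-cong (Q.inverseʳ y) i a ⟩
    act ε i a                ≡⟨ act-ε i a ⟩
    a                        ∎

  act-inverseˡ : ∀ y i a → act (y ⁻¹) i (act y i a) ≡ a
  act-inverseˡ y i a = begin
    act (y ⁻¹) i (act y i a) ≡⟨ act-∙ (y ⁻¹) y i a ⟨
    act (y ⁻¹ ∙ y) i a       ≡⟨ act-cong (Q.inverseˡ y) i a ⟩
    act ε i a                ≡⟨ act-ε i a ⟩
    a                        ∎

  act-α-rep⁻¹≡base : ∀ i a → act (α (P.rep i a) ⁻¹) i a ≡ P.base i
  act-α-rep⁻¹≡base i a = ᾱ-injective i (begin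
    ᾱ i (act (α (P.rep i a) ⁻¹) i a)                ≡⟨ ᾱ-act _ i a ⟩
    Q.coset i (α (P.rep i a) ⁻¹ ∙ α (P.rep i a))    ≡⟨ Q.coset-cong i (Q.inverseˡ _) ⟩
    Q.base i                                        ≡⟨ ᾱ-base i ⟨
    ᾱ i (P.base i)                                  ∎)

  ∈H⇒act-fixes-base : ∀ i {y} → Q.H i y → act y i (P.base i) ≡ P.base i
  ∈H⇒act-fixes-base i {y} y∈H = ᾱ-injective i (begin
    ᾱ i (act y i (P.base i)) ≡⟨ ᾱ-act-base y i ⟩
    Q.coset i y              ≡⟨ Q.∈H⇒coset≡cosetε i y∈H ⟩
    Q.base i                 ≡⟨ ᾱ-base i ⟨
    ᾱ i (P.base i)           ∎)

  act⁻¹∙act-fixes-base⇒∈H : ∀ i y₁ y₂ → act (y₁ ⁻¹) i (act y₂ i (P.base i)) ≡ P.base i →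
                             Q.H i (y₁ ⁻¹ ∙ y₂)
  act⁻¹∙act-fixes-base⇒∈H i y₁ y₂ fixed = Q.coset≡⇒∈H i (begin
    Q.coset i y₁                                         ≡⟨ ᾱ-act-base y₁ i ⟨
    ᾱ i (act y₁ i (P.base i))                            ≡⟨ cong (ᾱ i ∘ act y₁ i) fixed ⟨
    ᾱ i (act y₁ i (act (y₁ ⁻¹) i (act y₂ i (P.base i)))) ≡⟨ cong (ᾱ i) (act-inverseʳ y₁ i _) ⟩
    ᾱ i (act y₂ i (P.base i))                            ≡⟨ ᾱ-act-base y₂ i ⟩
    Q.coset i y₂                                         ∎)

  -- a ↦ s (repᴷ 0 a) H₁ is an injection H₀/K → G/H₁ between sets of size n, hence onto.
  α-hits-every-point : ∀ y → ∃[ g ] ∀ k → Q.coset k (α g) ≡ Q.coset k y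
  α-hits-every-point y = g , Q.coset≡-on-two⇒coset≡ {zero} {suc zero} (λ ()) coset₀ coset₁
    where
    s = preimage zero y

    f : Fin n → Fin n
    f a = P.coset (suc zero) (s P.∙ P.repᴷ zero a)

    f-injective : Injective _≡_ _≡_ f
    f-injective {a} {a′} eq = P.repᴷ-injective zero (P.H∩H⊆K {zero} {suc zero} (λ ())
      (P.Hᵢ.∙-mem zero (P.Hᵢ.⁻¹-mem zero (P.repᴷ∈H zero a)) (P.repᴷ∈H zero a′))
      (P.Hᵢ.resp (suc zero) (CancellationLemmas.[x∙y]⁻¹∙[x∙z]≈y⁻¹∙z P.G s _ _)
                            (P.coset≡⇒∈H (suc zero) eq)))

    a = proj₁ (injective⇒surjective f-injective (P.coset (suc zero) (preimage (suc zero) y)))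
    g = s P.∙ P.repᴷ zero a

    coset₀ : Q.coset zero (α g) ≡ Q.coset zero y
    coset₀ = ≡.trans (coset-α zero (P.coset-∙∈H zero s (P.repᴷ∈H zero a)))
                     (coset-α-preimage zero y)

    coset₁ : Q.coset (suc zero) (α g) ≡ Q.coset (suc zero) y
    coset₁ = ≡.trans (coset-α (suc zero) (proj₂ (injective⇒surjective f-injective _)))
                     (coset-α-preimage (suc zero) y)

  act-preservesPoints : ∀ y → PreservesPoints (act y)
  act-preservesPoints y g = g′ , λ k → ᾱ-injective k (begin
    ᾱ k (act y k (P.coset k g)) ≡⟨ ᾱ-act-coset y k g ⟩
    Q.coset k (y ∙ α g)         ≡⟨ proj₂ (α-hits-every-point (y ∙ α g)) k ⟨
    Q.coset k (α g′)            ≡⟨ ᾱ-coset k g′ ⟨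
    ᾱ k (P.coset k g′)          ∎)
    where g′ = proj₁ (α-hits-every-point (y ∙ α g))

  toAutomorphism : Q.Carrier → Automorphism
  toAutomorphism y = record
    { perm        = λ i → Perm.permutation (act y i) (act (y ⁻¹) i)
                                           (act-inverseʳ y i) (act-inverseˡ y i)
    ; preserves   = act-preservesPoints y
    ; preserves⁻¹ = act-preservesPoints (y ⁻¹)
    }

  toAutomorphism-isGroupHomomorphism :
    IsGroupHomomorphism Q.rawGroup (Group.rawGroup AutGroup) toAutomorphism
  toAutomorphism-isGroupHomomorphism = record
    { isMonoidHomomorphism = record
      { isMagmaHomomorphism = record
        { isRelHomomorphism = record { cong = λ y≈y′ → lift (act-cong y≈y′) }
        ; homo              = λ y₁ y₂ → lift (act-∙ y₁ y₂)
        }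
      ; ε-homo = lift act-ε
      }
    ; ⁻¹-homo = λ _ → lift λ _ _ → ≡.refl
    }

module AutomorphismPacket {c ℓ p : Level} {q n : ℕ} (P : GroupPacket c ℓ p (suc (suc q)) n) where
  open PacketProperties P
  open CosetGeometry P
  private module Translation = Transport (admissible-id P)

  translate : Carrier → Automorphism
  translate = Translation.toAutomorphism

  translate-coset : ∀ x k g → perm (translate x) k ⟨$⟩ʳ coset k g ≡ coset k (x ∙ g)
  translate-coset x k g = coset-∙ˡ k x (coset-rep k (coset k g))

  imageOfε : Automorphism → Carrier
  imageOfε s = proj₁ (preserves s ε)

  imageOfε-coset : ∀ s k → perm s k ⟨$⟩ʳ base k ≡ coset k (imageOfε s)
  imageOfε-coset s = proj₂ (preserves s ε)

  translate⁻¹∙-base : ∀ x s k →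
                      perm (translate x ⁻¹ᴬ ∙ᴬ s) k ⟨$⟩ʳ base k ≡ coset k (x ⁻¹ ∙ imageOfε s)
  translate⁻¹∙-base x s k = ≡.trans (cong (perm (translate (x ⁻¹)) k ⟨$⟩ʳ_) (imageOfε-coset s k))
                                    (translate-coset (x ⁻¹) k _)

  ∈H⇒Stab : ∀ i x s → H i (x ⁻¹ ∙ imageOfε s) → Stab i (translate x ⁻¹ᴬ ∙ᴬ s)
  ∈H⇒Stab i x s x⁻¹s∈H = lift (≡.trans (translate⁻¹∙-base x s i) (∈H⇒coset≡cosetε i x⁻¹s∈H))

  Stab⇒∈H : ∀ i x s → Stab i (translate x ⁻¹ᴬ ∙ᴬ s) → H i (x ⁻¹ ∙ imageOfε s)
  Stab⇒∈H i x s (lift fixed) =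
    coset≡cosetε⇒∈H i (≡.trans (≡.sym (translate⁻¹∙-base x s i)) fixed)

  ∈K⇒StabAll : ∀ x s → K (x ⁻¹ ∙ imageOfε s) → StabAll (translate x ⁻¹ᴬ ∙ᴬ s)
  ∈K⇒StabAll x s x⁻¹s∈K k = ∈H⇒Stab k x s (K⊆H k x⁻¹s∈K)

  StabAll⇒∈K : ∀ x s → StabAll (translate x ⁻¹ᴬ ∙ᴬ s) → K (x ⁻¹ ∙ imageOfε s)
  StabAll⇒∈K x s fixed =
    H∩H⊆K {zero} {suc zero} (λ ()) (Stab⇒∈H zero x s (fixed zero))
                                   (Stab⇒∈H (suc zero) x s (fixed (suc zero)))

  Stab⇒imageOfε∈H : ∀ i s → Stab i s → H i (imageOfε s)
  Stab⇒imageOfε∈H i s (lift fixed) =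
    coset≡cosetε⇒∈H i (≡.trans (≡.sym (imageOfε-coset s i)) fixed)

  ∈H⇒translate∈Stab : ∀ i {h} → H i h → Stab i (translate h)
  ∈H⇒translate∈Stab i {h} h∈H =
    lift (≡.trans (translate-coset h i ε) (∈H⇒coset≡cosetε i (Hᵢ.∙-mem i h∈H (Hᵢ.ε-mem i))))

  -- s lies in the coset (translate x) Stab i exactly when imageOfε s lies in x H i, so the
  -- index data of H i in G serves for Stab i in AutGroup, and likewise for K and StabAll.
  Stab-index : ∀ i → IndexInGroup AutGroup (Stab i) n
  Stab-index i = (λ a → translate (rep i a)) , λ s →
    let a , spec , unique = proj₂ (idxG i) (imageOfε s)
    in a , ∈H⇒Stab i _ s spec , λ b fixed → unique b (Stab⇒∈H i _ s fixed)

  StabAll-index : ∀ i → IndexIn AutGroup (Stab i) StabAll n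
  StabAll-index i =
    (λ a → translate (repᴷ i a)) , (λ a → ∈H⇒translate∈Stab i (repᴷ∈H i a)) , λ s s∈Stab →
    let a , spec , unique = Kcoset i (imageOfε s) (Stab⇒imageOfε∈H i s s∈Stab)
    in a , ∈K⇒StabAll _ s spec , λ b fixed → unique b (StabAll⇒∈K _ s fixed)

  AutPacket : GroupPacket c ℓ p (suc (suc q)) n
  AutPacket = record
    { G     = AutGroup
    ; H     = Stab
    ; H-sub = Stab-sub
    ; K     = StabAll
    ; K-sub = StabAll-sub
    ; meet  = meetᴬ
    ; idxG  = Stab-index
    ; idxH  = StabAll-index
    }

open AutomorphismPacket using (AutPacket)

toAutPacket : ∀ {c ℓ p : Level} {q n : ℕ} {P Q : GroupPacket c ℓ p (suc (suc q)) n} →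
              Admissible P Q → Admissible Q (AutPacket P)
toAutPacket {P = P} β = record
  { α    = toAutomorphism
  ; hom  = toAutomorphism-isGroupHomomorphism
  ; maps = λ i _ y∈H → lift (∈H⇒act-fixes-base i y∈H)
  ; surj = λ i s → α (P.rep i (perm s i ⟨$⟩ʳ P.base i)) , lift (act-α-rep⁻¹≡base i _)
  ; inj  = λ i y₁ y₂ (lift fixed) → act⁻¹∙act-fixes-base⇒∈H i y₁ y₂ fixed
  }
  where
  open Transport β
  open Admissible β using (α)
  open CosetGeometry P using (perm)
  module P = PacketProperties P

corollary3p16 : {c ℓ p : Level} (q n : ℕ) →
                IsEquivalence (_∼GP_ {c} {ℓ} {p} {suc (suc q)} {n})
corollary3p16 q n = record
  { refl  = λ {P} → P , admissible-id P , admissible-id P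
  ; sym   = λ (R , α , β) → R , β , α
  ; trans = λ {_} {P′} (_ , α , β) (_ , γ , δ) →
      AutPacket P′ , admissible-∘ (toAutPacket β) α , admissible-∘ (toAutPacket γ) δ
  }
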